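{- Let $\langle V,O,\mathrm{label},\mathrm{or},<\rangle$ be the structure associated with a type (or sequent), and let $a,b\in V$ with $a\,O^*\,b$ and $d(a)\neq d(b)$. (1) If $d(b)$ is even, then $a<H(b)$. (2) If $d(b)$ is odd, then $H(b)<a$.
   Context: Types are built from primitive types $p_1,p_2,\dots$ using the binary connective $\backslash$ and the unary connective $!$. To each type $T$ associate a rooted tree $\langle V,O\rangle$ (arcs directed towards the root; $O$ is also viewed as the parent function on non-root vertices), its set of leaves $W$, a labelling $\mathrm{label}:W\to\{p_1,p_2,\dots\}$, an arc labelling $\mathrm{or}:O\to\{ -1,1,2\}$ and a strict linear order $<$ on $V$, inductively: for a primitive type $p$, a single vertex labelled $p$; for $!A$, take the structure of $A$, add a new root and an arc labelled $2$ from the root of $A$ to the new root, and order so that the new root is the least element, the rest ordered as for $A$; for $A\backslash B$, take the disjoint union of the structures for $A$ and $B$, add a new root, an arc labelled $-1$ from the root of $A$ and an arc labelled $1$ from the root of $B$ to the new root, and order $V$ as: the reversed order of the $A$-part, then the new root, then the order of the $B$-part. The structure of a sequent $A_1\dots A_n\to B$ is that of the type $A_n\backslash(A_{n-1}\backslash\cdots\backslash(A_1\backslash B)\cdots)$ (that of $B$ if $n=0$). Notation: $d(a)$ is the number of arcs labelled $-1$ on the path from $a$ to the root; $H(a)$ is the unique leaf from which a path to $a$ contains no arc labelled $-1$; $O^*$ is the reflexive–transitive closure of $O$. -}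

module Defs where

open import Data.Nat using (ℕ; zero; suc)
open import Data.List using (List; []; _∷_; _++_; [_])
open import Data.Bool using (Bool; true; false)

data Tp : Set where
  prim : ℕ → Tp
  _⧵_  : Tp → Tp → Tp
  !_   : Tp → Tp

-- Sequent A_1 ... A_n → B is the type A_n \ (... \ (A_1 \ B))
-- (antecedents listed A_1 first)
seqTp : List Tp → Tp → Tp
seqTp []       B = B
seqTp (A ∷ As) B = seqTp As (A ⧵ B)

-- Vertices of the tree of T: positions in T.
-- here = the root added for T; inBang / inL / inR = vertices of the
-- sub-structure for A (in !A), A (in A\B), B (in A\B).
data Pos : Tp → Set where
  here   : ∀ {T} → Pos T
  inBang : ∀ {A} → Pos A → Pos (! A)
  inL    : ∀ {A B} → Pos A → Pos (A ⧵ B)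
  inR    : ∀ {A B} → Pos B → Pos (A ⧵ B)

data Leaf : ∀ {T} → Pos T → Set where
  leaf   : ∀ {n} → Leaf {prim n} here
  inBang : ∀ {A} {p : Pos A} → Leaf p → Leaf (inBang p)
  inL    : ∀ {A B} {p : Pos A} → Leaf p → Leaf {A ⧵ B} (inL p)
  inR    : ∀ {A B} {p : Pos B} → Leaf p → Leaf {A ⧵ B} (inR p)

-- Parent relation O : O a b  means there is an arc from a to b (b = parent of a)
data O : ∀ {T} → Pos T → Pos T → Set where
  bang-top : ∀ {A} → O {T = ! A} (inBang here) here
  bang     : ∀ {A} {p q : Pos A} → O p q → O (inBang p) (inBang q)
  l-top    : ∀ {A B} → O {A ⧵ B} (inL here) here
  l        : ∀ {A B} {p q : Pos A} → O p q → O {A ⧵ B} (inL p) (inL q)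
  r-top    : ∀ {A B} → O {A ⧵ B} (inR here) here
  r        : ∀ {A B} {p q : Pos B} → O p q → O {A ⧵ B} (inR p) (inR q)

data O* {T : Tp} : Pos T → Pos T → Set where
  ε   : ∀ {a} → O* a a
  _◅_ : ∀ {a b c} → O a b → O* b c → O* a c

data Or : Set where
  m1 one two : Or

pathOr : ∀ {T} → Pos T → List Or
pathOr here       = []
pathOr (inBang p) = pathOr p ++ [ two ]
pathOr (inL p)    = pathOr p ++ [ m1 ]
pathOr (inR p)    = pathOr p ++ [ one ]

countM1 : List Or → ℕ
countM1 []        = 0
countM1 (m1 ∷ xs) = suc (countM1 xs)
countM1 (_  ∷ xs) = countM1 xs

d : ∀ {T} → Pos T → ℕ
d a = countM1 (pathOr a)

hd : (T : Tp) → Pos T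
hd (prim n) = here
hd (A ⧵ B)  = inR (hd B)
hd (! A)    = inBang (hd A)

-- H(a): the unique leaf from which the path to a contains no arc labelled -1
H : ∀ {T} → Pos T → Pos T
H {T} here  = hd T
H (inBang p) = inBang (H p)
H (inL p)    = inL (H p)
H (inR p)    = inR (H p)

data _≺_ : ∀ {T} → Pos T → Pos T → Set where
  bang-root : ∀ {A} {p : Pos A} → _≺_ {T = ! A} here (inBang p)
  bang      : ∀ {A} {p q : Pos A} → p ≺ q → inBang p ≺ inBang q
  -- A\B : reversed A-part, then root, then B-part
  LL   : ∀ {A B} {p q : Pos A} → q ≺ p → _≺_ {A ⧵ B} (inL p) (inL q)
  Lroot : ∀ {A B} {p : Pos A} → _≺_ {A ⧵ B} (inL p) here
  LR   : ∀ {A B} {p : Pos A} {q : Pos B} → _≺_ {A ⧵ B} (inL p) (inR q)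
  rootR : ∀ {A B} {q : Pos B} → _≺_ {A ⧵ B} here (inR q)
  RR   : ∀ {A B} {p q : Pos B} → p ≺ q → _≺_ {A ⧵ B} (inR p) (inR q)

module Submission where

-- Entering the
-- argument A of A \ B adds a −1 arc, which flips the parity of d, and reverses
-- the order on that part, which swaps the two conclusions; the other
-- constructors change neither.  The base case is b = root of the current
-- subtree, where d b = 0 and H b is the head leaf: every vertex with d a ≠ 0
-- hangs off the 1/2-spine on its −1 side and so precedes the head.

open import Defs
open import Data.Nat using (ℕ; zero; suc; _+_)
open import Data.Nat.Divisibility using (_∣_; _∣0; n∣n; ∣1⇒≡1; ∣m∣n⇒∣m+n; ∣m+n∣m⇒∣n)
open import Data.Nat.Properties using (+-comm; +-identityʳ)
open import Data.Product using (_×_; _,_)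
open import Data.Sum using (_⊎_; inj₁; inj₂)
open import Data.List using ([]; _∷_; _++_; [_])
open import Function using (_∘_)
open import Relation.Nullary using (¬_; contradiction)
open import Relation.Binary.PropositionalEquality using (_≡_; _≢_; refl; trans; cong; subst)

even⊎odd : ∀ n → 2 ∣ n ⊎ 2 ∣ suc n
even⊎odd zero    = inj₁ (2 ∣0)
even⊎odd (suc n) with even⊎odd n
... | inj₁ 2∣n   = inj₂ (∣m∣n⇒∣m+n n∣n 2∣n)
... | inj₂ 2∣1+n = inj₁ 2∣1+n

2∤n⇒2∣1+n : ∀ {n} → ¬ 2 ∣ n → 2 ∣ suc n
2∤n⇒2∣1+n {n} 2∤n with even⊎odd n
... | inj₁ 2∣n   = contradiction 2∣n 2∤n
... | inj₂ 2∣1+n = 2∣1+n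

2∣2+n⇒2∣n : ∀ {n} → 2 ∣ suc (suc n) → 2 ∣ n
2∣2+n⇒2∣n 2∣2+n = ∣m+n∣m⇒∣n 2∣2+n n∣n

2∤1 : ¬ 2 ∣ 1
2∤1 2∣1 with ∣1⇒≡1 2∣1
... | ()

countM1-++ : ∀ xs ys → countM1 (xs ++ ys) ≡ countM1 xs + countM1 ys
countM1-++ []          ys = refl
countM1-++ (m1  ∷ xs) ys = cong suc (countM1-++ xs ys)
countM1-++ (one ∷ xs) ys = countM1-++ xs ys
countM1-++ (two ∷ xs) ys = countM1-++ xs ys

depth : ∀ {T} → Pos T → ℕ
depth here       = 0
depth (inBang p) = depth p
depth (inL p)    = suc (depth p)
depth (inR p)    = depth p

d≡depth : ∀ {T} (a : Pos T) → d a ≡ depth a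
d≡depth here       = refl
d≡depth (inBang p) =
  trans (countM1-++ (pathOr p) [ two ]) (trans (+-identityʳ (d p)) (d≡depth p))
d≡depth (inL p)    =
  trans (countM1-++ (pathOr p) [ m1 ]) (trans (+-comm (d p) 1) (cong suc (d≡depth p)))
d≡depth (inR p)    =
  trans (countM1-++ (pathOr p) [ one ]) (trans (+-identityʳ (d p)) (d≡depth p))

O*-inL⁻¹ : ∀ {A B} {p q : Pos A} → O* {A ⧵ B} (inL p) (inL q) → O* p q
O*-inL⁻¹ ε                 = ε
O*-inL⁻¹ (l p→p′ ◅ p′↝q)   = p→p′ ◅ O*-inL⁻¹ p′↝q
O*-inL⁻¹ (l-top ◅ (() ◅ _))

O*-inR⁻¹ : ∀ {A B} {p q : Pos B} → O* {A ⧵ B} (inR p) (inR q) → O* p q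
O*-inR⁻¹ ε                 = ε
O*-inR⁻¹ (r p→p′ ◅ p′↝q)   = p→p′ ◅ O*-inR⁻¹ p′↝q
O*-inR⁻¹ (r-top ◅ (() ◅ _))

O*-inBang⁻¹ : ∀ {A} {p q : Pos A} → O* { ! A } (inBang p) (inBang q) → O* p q
O*-inBang⁻¹ ε                    = ε
O*-inBang⁻¹ (bang p→p′ ◅ p′↝q)   = p→p′ ◅ O*-inBang⁻¹ p′↝q
O*-inBang⁻¹ (bang-top ◅ (() ◅ _))

¬O*-inL-inR : ∀ {A B} {p : Pos A} {q : Pos B} → ¬ O* {A ⧵ B} (inL p) (inR q)
¬O*-inL-inR (l _ ◅ p′↝q)     = ¬O*-inL-inR p′↝q
¬O*-inL-inR (l-top ◅ (() ◅ _))

¬O*-inR-inL : ∀ {A B} {p : Pos B} {q : Pos A} → ¬ O* {A ⧵ B} (inR p) (inL q)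
¬O*-inR-inL (r _ ◅ p′↝q)     = ¬O*-inR-inL p′↝q
¬O*-inR-inL (r-top ◅ (() ◅ _))

≺-hd : ∀ {T} (a : Pos T) → depth a ≢ 0 → a ≺ hd T
≺-hd here       d≢0 = contradiction refl d≢0
≺-hd (inBang p) d≢0 = bang (≺-hd p d≢0)
≺-hd (inL p)    d≢0 = LR
≺-hd (inR p)    d≢0 = RR (≺-hd p d≢0)

mutual
  ≺-H-even : ∀ {T} {a b : Pos T} → O* a b → depth a ≢ depth b → 2 ∣ depth b → a ≺ H b
  ≺-H-even {a = a}        {here}     _    d≢ _  = ≺-hd a d≢
  ≺-H-even {a = here}     {inBang _} (() ◅ _)
  ≺-H-even {a = here}     {inL _}    (() ◅ _)
  ≺-H-even {a = here}     {inR _}    (() ◅ _)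
  ≺-H-even {a = inBang _} {inBang _} a↝b d≢ 2∣ = bang (≺-H-even (O*-inBang⁻¹ a↝b) d≢ 2∣)
  ≺-H-even {a = inL _}    {inL _}    a↝b d≢ 2∣ = LL (H-≺-odd (O*-inL⁻¹ a↝b) (d≢ ∘ cong suc) 2∣)
  ≺-H-even {a = inR _}    {inR _}    a↝b d≢ 2∣ = RR (≺-H-even (O*-inR⁻¹ a↝b) d≢ 2∣)
  ≺-H-even {a = inL _}    {inR _}    a↝b = contradiction a↝b ¬O*-inL-inR
  ≺-H-even {a = inR _}    {inL _}    a↝b = contradiction a↝b ¬O*-inR-inL

  H-≺-odd : ∀ {T} {a b : Pos T} → O* a b → depth a ≢ depth b → 2 ∣ suc (depth b) → H b ≺ a
  H-≺-odd {b = here}                 _    _  2∣1 = contradiction 2∣1 2∤1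
  H-≺-odd {a = here}     {inBang _} (() ◅ _)
  H-≺-odd {a = here}     {inL _}    (() ◅ _)
  H-≺-odd {a = here}     {inR _}    (() ◅ _)
  H-≺-odd {a = inBang _} {inBang _} a↝b d≢ 2∣ = bang (H-≺-odd (O*-inBang⁻¹ a↝b) d≢ 2∣)
  H-≺-odd {a = inL _}    {inL _}    a↝b d≢ 2∣ = LL (≺-H-even (O*-inL⁻¹ a↝b) (d≢ ∘ cong suc) (2∣2+n⇒2∣n 2∣))
  H-≺-odd {a = inR _}    {inR _}    a↝b d≢ 2∣ = RR (H-≺-odd (O*-inR⁻¹ a↝b) d≢ 2∣)
  H-≺-odd {a = inL _}    {inR _}    a↝b = contradiction a↝b ¬O*-inL-inR
  H-≺-odd {a = inR _}    {inL _}    a↝b = contradiction a↝b ¬O*-inR-inL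

lemma2p2 : (T : Tp) (a b : Pos T) → O* a b → d a ≢ d b →
    (2 ∣ d b → a ≺ H b) × (¬ (2 ∣ d b) → H b ≺ a)
lemma2p2 T a b a↝b d≢ rewrite d≡depth b =
  ≺-H-even a↝b depth≢ , H-≺-odd a↝b depth≢ ∘ 2∤n⇒2∣1+n
  where
  depth≢ : depth a ≢ depth b
  depth≢ = subst (_≢ depth b) (d≡depth a) d≢
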